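{- For $n\ge1$, the vertices of the freehedron $\mathcal{F}^n$ are exactly the points $v=(v_1,\dots,v_n)\in\{0,1,2\}^n$ satisfying the condition $\bigstar$: whenever $v_i=1$, one has $i>1$ and $v_j\neq0$ for all $j<i$.
   Context: Freehedra are defined inductively as cell decompositions of cubes, each coming with a distinguished facet. $\mathcal{F}^1$ is the interval $[0,2]$ (cells: the vertices $\{0\},\{2\}$ and the edge $[0,2]$), with distinguished facet $X^1=\{2\}$. Given $\mathcal{F}^{n-1}$, a cell decomposition of $[0,2]^{n-1}$ with distinguished facet $X^{n-1}$, the cells of $\mathcal{F}^n$ (a cell decomposition of $[0,2]^n=[0,2]^{n-1}\times[0,2]$) are: for every cell $G$ of $\mathcal{F}^{n-1}$, the cells $G\times\{0\}$ and $G\times\{2\}$; if $G\not\subseteq X^{n-1}$, the cell $G\times[0,2]$; if $G\subseteq X^{n-1}$, the cells $G\times[0,1]$, $G\times\{1\}$, $G\times[1,2]$ (i.e. the facet $X^{n-1}\times[0,2]$ is split into $X^{n-1}\times[0,1]$ and $X^{n-1}\times[1,2]$). The distinguished facet is $X^n=X^{n-1}\times[1,2]$. The vertices of $\mathcal{F}^n$ are its $0$-dimensional cells, viewed as points of $[0,2]^n$. -}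

module Defs where

open import Data.Nat using (ℕ; zero; suc; _<_; _≤_)
open import Data.Fin using (Fin; toℕ) renaming (zero to fz; suc to fs)
open import Data.Vec using (Vec; []; _∷_; _∷ʳ_; map; lookup)
open import Data.Vec.Relation.Binary.Pointwise.Inductive using (Pointwise)
open import Data.Product using (_×_)
open import Relation.Binary.PropositionalEquality using (_≡_; _≢_)
open import Relation.Nullary using (¬_)

-- Cells of [0,2] subdivided at 1 (the only subintervals that occur):
-- points {0},{1},{2} and intervals [0,1],[1,2],[0,2].
data Iv : Set where
  p0 p1 p2 i01 i12 i02 : Iv

data _⊑_ : Iv → Iv → Set where
  ⊑-refl : ∀ {a} → a ⊑ a
  p0⊑i01 : p0 ⊑ i01
  p1⊑i01 : p1 ⊑ i01
  p1⊑i12 : p1 ⊑ i12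
  p2⊑i12 : p2 ⊑ i12
  p0⊑i02 : p0 ⊑ i02
  p1⊑i02 : p1 ⊑ i02
  p2⊑i02 : p2 ⊑ i02
  i01⊑i02 : i01 ⊑ i02
  i12⊑i02 : i12 ⊑ i02

-- A box in [0,2]^n is a product of such sets; coordinate k (0-based) is
-- the k-th entry; new coordinates are appended at the end (F^n = F^{n-1} × [0,2]).
Box : ℕ → Set
Box n = Vec Iv n

-- containment of (nonempty) product sets is coordinatewise containment
_⊆ᴮ_ : ∀ {n} → Box n → Box n → Set
G ⊆ᴮ H = Pointwise _⊑_ G H

-- distinguished facet X^n  (X^0 is unused)
X : (n : ℕ) → Box n
X zero = []
X (suc zero) = p2 ∷ []
X (suc (suc n)) = X (suc n) ∷ʳ i12

data FreeCell : (n : ℕ) → Box n → Set where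
  base0 : FreeCell 1 (p0 ∷ [])
  base2 : FreeCell 1 (p2 ∷ [])
  baseI : FreeCell 1 (i02 ∷ [])
  bottom : ∀ {n G} → FreeCell n G → FreeCell (suc n) (G ∷ʳ p0)
  top    : ∀ {n G} → FreeCell n G → FreeCell (suc n) (G ∷ʳ p2)
  whole  : ∀ {n G} → FreeCell n G → ¬ (G ⊆ᴮ X n) → FreeCell (suc n) (G ∷ʳ i02)
  lower  : ∀ {n G} → FreeCell n G → G ⊆ᴮ X n → FreeCell (suc n) (G ∷ʳ i01)
  middle : ∀ {n G} → FreeCell n G → G ⊆ᴮ X n → FreeCell (suc n) (G ∷ʳ p1)
  upper  : ∀ {n G} → FreeCell n G → G ⊆ᴮ X n → FreeCell (suc n) (G ∷ʳ i12)

pt : Fin 3 → Iv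
pt fz = p0
pt (fs fz) = p1
pt (fs (fs fz)) = p2

-- v ∈ {0,1,2}^n is a vertex of F^n: the 0-dimensional box {v} is a cell
IsVertex : (n : ℕ) → Vec (Fin 3) n → Set
IsVertex n v = FreeCell n (map pt v)

one zero' : Fin 3
one = fs fz
zero' = fz

-- Condition ★ with 0-based indices: whenever v_i = 1, i is not the first
-- coordinate and v_j ≠ 0 for all j < i.
Star : (n : ℕ) → Vec (Fin 3) n → Set
Star n v = ∀ (i : Fin n) → lookup v i ≡ one →
  (1 ≤ toℕ i) × (∀ (j : Fin n) → toℕ j < toℕ i → lookup v j ≢ zero')

{-# OPTIONS --safe #-}
-- The vertices of
-- F^(n+1) are v × {0} and v × {2} for every vertex v of F^n, together with v × {1}
-- when v lies in the facet X^n = {2} × [1,2]^(n-1), i.e. when v₁ = 2 and no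
-- coordinate of v is 0.  Condition ★ obeys the same recursion: a new last coordinate
-- 1 is allowed exactly when no earlier coordinate is 0, and ★ itself rules out v₁ = 1.
module Submission where

open import Defs
open import Data.Nat using (ℕ; _≤_)
open import Data.Fin using (Fin)
open import Data.Vec using (Vec)
open import Function.Bundles using (_⇔_)

open import Data.Nat using (zero; suc; _<_; z≤n; s≤s)
open import Data.Nat.Properties using (<-irrefl; <-≤-trans; <⇒≤; ≤-refl)
open import Data.Fin using (toℕ; inject₁; fromℕ) renaming (zero to fz; suc to fs)
open import Data.Fin.Properties using (toℕ-inject₁; toℕ-fromℕ; toℕ<n)
open import Data.Maybe using (Maybe; just; nothing)
open import Data.Vec using ([]; _∷_; _∷ʳ_; map; lookup; replicate; head; initLast)
open import Data.Vec.Properties using (map-∷ʳ; ∷ʳ-injective; ∷-injectiveˡ)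
open import Data.Vec.Relation.Binary.Pointwise.Inductive using ([]; _∷_)
open import Data.Vec.Relation.Unary.All using (All; []; _∷_)
open import Data.Vec.Relation.Unary.All.Properties using (lookup⁺; lookup⁻)
open import Data.Product using (_×_; _,_; proj₂)
open import Relation.Binary.PropositionalEquality using (_≡_; _≢_; refl; sym; trans; cong; subst)
open import Relation.Nullary using (contradiction)
open import Function.Bundles using (mk⇔; Equivalence)
open import Function.Properties.Equivalence using () renaming (trans to ⇔-trans; sym to ⇔-sym)

private
  variable
    m n : ℕ

open Equivalence

data InitOrLast : Fin (suc n) → Set where
  init : (j : Fin n) → InitOrLast (inject₁ j)
  last : InitOrLast (fromℕ n)

initOrLast : (i : Fin (suc n)) → InitOrLast i
initOrLast {zero}  fz     = last
initOrLast {suc n} fz     = init fz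
initOrLast {suc n} (fs i) with initOrLast i
... | init j = init (fs j)
... | last   = last

lookup-∷ʳ-inject₁ : ∀ {A : Set} (v : Vec A n) (a : A) (j : Fin n) → lookup (v ∷ʳ a) (inject₁ j) ≡ lookup v j
lookup-∷ʳ-inject₁ (b ∷ v) a fz     = refl
lookup-∷ʳ-inject₁ (b ∷ v) a (fs j) = lookup-∷ʳ-inject₁ v a j

lookup-∷ʳ-fromℕ : ∀ {A : Set} (v : Vec A n) (a : A) → lookup (v ∷ʳ a) (fromℕ n) ≡ a
lookup-∷ʳ-fromℕ []      a = refl
lookup-∷ʳ-fromℕ (b ∷ v) a = lookup-∷ʳ-fromℕ v a

NonzeroBelow : Vec (Fin 3) n → ℕ → Set
NonzeroBelow {n} v k = ∀ (j : Fin n) → toℕ j < k → lookup v j ≢ zero'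

nonzeroBelow-∷ʳ⁺ : ∀ {k} (w : Vec (Fin 3) n) c → k ≤ n → NonzeroBelow w k → NonzeroBelow (w ∷ʳ c) k
nonzeroBelow-∷ʳ⁺ {n} w c k≤n below j j<k with initOrLast j
... | init j′ rewrite lookup-∷ʳ-inject₁ w c j′ | toℕ-inject₁ j′ = below j′ j<k
... | last    = contradiction (<-≤-trans j<k k≤n) (<-irrefl (toℕ-fromℕ n))

nonzeroBelow-∷ʳ⁻ : ∀ {k} (w : Vec (Fin 3) n) c → NonzeroBelow (w ∷ʳ c) k → NonzeroBelow w k
nonzeroBelow-∷ʳ⁻ w c below j j<k =
  subst (_≢ zero') (lookup-∷ʳ-inject₁ w c j) (below (inject₁ j) (subst (_< _) (sym (toℕ-inject₁ j)) j<k))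

star-∷ʳ : ∀ {w : Vec (Fin 3) n} {c} →
  Star (suc n) (w ∷ʳ c) ⇔ (Star n w × (c ≡ one → 1 ≤ n × All (_≢ zero') w))
star-∷ʳ {n} {w} {c} = mk⇔ split join
  where
  split : Star (suc n) (w ∷ʳ c) → Star n w × (c ≡ one → 1 ≤ n × All (_≢ zero') w)
  split st = star-init , star-last
    where
    star-init : Star n w
    star-init i e with st (inject₁ i) (trans (lookup-∷ʳ-inject₁ w c i) e)
    ... | 1≤i , below rewrite toℕ-inject₁ i = 1≤i , nonzeroBelow-∷ʳ⁻ w c below
    star-last : c ≡ one → 1 ≤ n × All (_≢ zero') w
    star-last e with st (fromℕ n) (trans (lookup-∷ʳ-fromℕ w c) e)
    ... | 1≤n , below rewrite toℕ-fromℕ n = 1≤n , lookup⁻ λ j → nonzeroBelow-∷ʳ⁻ w c below j (toℕ<n j)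
  join : Star n w × (c ≡ one → 1 ≤ n × All (_≢ zero') w) → Star (suc n) (w ∷ʳ c)
  join (st , st-last) i e with initOrLast i
  ... | init i′ rewrite lookup-∷ʳ-inject₁ w c i′ | toℕ-inject₁ i′ with st i′ e
  ...   | 1≤i , below = 1≤i , nonzeroBelow-∷ʳ⁺ w c (<⇒≤ (toℕ<n i′)) below
  join (st , st-last) i e | last rewrite lookup-∷ʳ-fromℕ w c | toℕ-fromℕ n with st-last e
  ...   | 1≤n , nonzero = 1≤n , nonzeroBelow-∷ʳ⁺ w c ≤-refl λ j _ → lookup⁺ nonzero j

star⇒head≢one : ∀ (v : Vec (Fin 3) (suc n)) → Star (suc n) v → head v ≢ one
star⇒head≢one (x ∷ v) st e with st fz e
... | () , _

star₁ : ∀ x → Star 1 (x ∷ []) ⇔ x ≢ one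
star₁ x = mk⇔ (star⇒head≢one (x ∷ [])) λ x≢1 → λ { fz x≡1 → contradiction x≡1 x≢1 ; (fs ()) }

X-suc : ∀ m → X (suc m) ≡ p2 ∷ replicate m i12
X-suc zero    = refl
X-suc (suc m) = trans (cong (_∷ʳ i12) (X-suc m)) (cong (p2 ∷_) (replicate-∷ʳ m))
  where
  replicate-∷ʳ : ∀ k → replicate k i12 ∷ʳ i12 ≡ replicate (suc k) i12
  replicate-∷ʳ zero    = refl
  replicate-∷ʳ (suc k) = cong (i12 ∷_) (replicate-∷ʳ k)

pt-⊑-i12 : ∀ x → pt x ⊑ i12 ⇔ x ≢ zero'
pt-⊑-i12 fz           = mk⇔ (λ ()) (λ x≢0 → contradiction refl x≢0)
pt-⊑-i12 (fs fz)      = mk⇔ (λ _ ()) (λ _ → p1⊑i12)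
pt-⊑-i12 (fs (fs fz)) = mk⇔ (λ _ ()) (λ _ → p2⊑i12)

map-pt-⊆-replicate-i12 : (u : Vec (Fin 3) m) → map pt u ⊆ᴮ replicate m i12 ⇔ All (_≢ zero') u
map-pt-⊆-replicate-i12 []      = mk⇔ (λ _ → []) (λ _ → [])
map-pt-⊆-replicate-i12 (x ∷ u) = mk⇔
  (λ { (x⊑ ∷ u⊆) → to (pt-⊑-i12 x) x⊑ ∷ to (map-pt-⊆-replicate-i12 u) u⊆ })
  (λ { (x≢0 ∷ u≢0) → from (pt-⊑-i12 x) x≢0 ∷ from (map-pt-⊆-replicate-i12 u) u≢0 })

map-pt-⊆-X : (v : Vec (Fin 3) (suc m)) → map pt v ⊆ᴮ X (suc m) ⇔ (head v ≢ one × All (_≢ zero') v)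
map-pt-⊆-X {m} (x ∷ u) rewrite X-suc m with x
... | fz         = mk⇔ (λ { (() ∷ _) }) (λ { (_ , x≢0 ∷ _) → contradiction refl x≢0 })
... | fs fz      = mk⇔ (λ { (() ∷ _) }) (λ { (x≢1 , _) → contradiction refl x≢1 })
... | fs (fs fz) = mk⇔
  (λ { (_ ∷ u⊆) → (λ ()) , (λ ()) ∷ to (map-pt-⊆-replicate-i12 u) u⊆ })
  (λ { (_ , _ ∷ u≢0) → ⊑-refl ∷ from (map-pt-⊆-replicate-i12 u) u≢0 })

pt⁻¹ : Iv → Maybe (Fin 3)
pt⁻¹ p0 = just fz
pt⁻¹ p1 = just one
pt⁻¹ p2 = just (fs (fs fz))
pt⁻¹ _  = nothing

pt⁻¹-pt : ∀ c → pt⁻¹ (pt c) ≡ just c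
pt⁻¹-pt fz           = refl
pt⁻¹-pt (fs fz)      = refl
pt⁻¹-pt (fs (fs fz)) = refl

pt⁻¹-≡ : ∀ {a c} → a ≡ pt c → pt⁻¹ a ≡ just c
pt⁻¹-≡ {c = c} a≡pt = trans (cong pt⁻¹ a≡pt) (pt⁻¹-pt c)

vertex₁ : ∀ x → IsVertex 1 (x ∷ []) ⇔ x ≢ one
vertex₁ x = mk⇔ (λ cell → last-≢-one cell refl) (vertex x)
  where
  last-≢-one : ∀ {G} → FreeCell 1 G → G ≡ pt x ∷ [] → x ≢ one
  last-≢-one base0 eq with pt⁻¹-≡ (∷-injectiveˡ eq)
  ... | refl = λ ()
  last-≢-one base2 eq with pt⁻¹-≡ (∷-injectiveˡ eq)
  ... | refl = λ ()
  last-≢-one baseI eq with pt⁻¹-≡ (∷-injectiveˡ eq)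
  ... | ()
  last-≢-one (bottom ())
  last-≢-one (top ())
  last-≢-one (whole () _)
  last-≢-one (lower () _)
  last-≢-one (middle () _)
  last-≢-one (upper () _)
  vertex : ∀ x → x ≢ one → IsVertex 1 (x ∷ [])
  vertex fz           _   = base0
  vertex (fs fz)      x≢1 = contradiction refl x≢1
  vertex (fs (fs fz)) _   = base2

vertex-∷ʳ : ∀ (w : Vec (Fin 3) (suc n)) c →
  IsVertex (suc (suc n)) (w ∷ʳ c) ⇔ (IsVertex (suc n) w × (c ≡ one → map pt w ⊆ᴮ X (suc n)))
vertex-∷ʳ {n} w c = mk⇔ (λ cell → split cell (map-∷ʳ pt c w)) join
  where
  Conclusion : Set
  Conclusion = IsVertex (suc n) w × (c ≡ one → map pt w ⊆ᴮ X (suc n))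

  split-∷ʳ : ∀ {H a} → H ∷ʳ a ≡ map pt w ∷ʳ pt c → H ≡ map pt w × pt⁻¹ a ≡ just c
  split-∷ʳ eq with ∷ʳ-injective _ _ eq
  ... | H≡ , a≡ = H≡ , pt⁻¹-≡ a≡

  -- Cells are indexed by snoc vectors, which do not unify with map pt (w ∷ʳ c),
  -- so the index is matched through an explicit equation.
  split : ∀ {G} → FreeCell (suc (suc n)) G → G ≡ map pt w ∷ʳ pt c → Conclusion
  split (bottom cell) eq with split-∷ʳ eq
  ... | refl , refl = cell , λ ()
  split (top cell) eq with split-∷ʳ eq
  ... | refl , refl = cell , λ ()
  split (middle cell ⊆X) eq with split-∷ʳ eq
  ... | refl , refl = cell , λ _ → ⊆X
  split (whole _ _) eq with split-∷ʳ eq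
  ... | _ , ()
  split (lower _ _) eq with split-∷ʳ eq
  ... | _ , ()
  split (upper _ _) eq with split-∷ʳ eq
  ... | _ , ()

  join : Conclusion → IsVertex (suc (suc n)) (w ∷ʳ c)
  join (cell , ⊆X) = subst (FreeCell _) (sym (map-∷ʳ pt c w)) (extend c ⊆X)
    where
    extend : ∀ c → (c ≡ one → map pt w ⊆ᴮ X (suc n)) → FreeCell (suc (suc n)) (map pt w ∷ʳ pt c)
    extend fz           _   = bottom cell
    extend (fs fz)      ⊆X  = middle cell (⊆X refl)
    extend (fs (fs fz)) _   = top cell

vertex⇔star-∷ʳ : ∀ (w : Vec (Fin 3) (suc n)) c → IsVertex (suc n) w ⇔ Star (suc n) w →
  IsVertex (suc (suc n)) (w ∷ʳ c) ⇔ Star (suc (suc n)) (w ∷ʳ c)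
vertex⇔star-∷ʳ {n} w c ih = ⇔-trans (vertex-∷ʳ w c) (⇔-trans (mk⇔ to′ from′) (⇔-sym star-∷ʳ))
  where
  to′ : IsVertex (suc n) w × (c ≡ one → map pt w ⊆ᴮ X (suc n)) →
        Star (suc n) w × (c ≡ one → 1 ≤ suc n × All (_≢ zero') w)
  to′ (vertex , ⊆X) = to ih vertex , λ c≡1 → s≤s z≤n , proj₂ (to (map-pt-⊆-X w) (⊆X c≡1))
  from′ : Star (suc n) w × (c ≡ one → 1 ≤ suc n × All (_≢ zero') w) →
          IsVertex (suc n) w × (c ≡ one → map pt w ⊆ᴮ X (suc n))
  from′ (star , nonzero) = from ih star ,
    λ c≡1 → from (map-pt-⊆-X w) (star⇒head≢one w star , proj₂ (nonzero c≡1))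

mainTheorem2 : (n : ℕ) → 1 ≤ n → (v : Vec (Fin 3) n) → IsVertex n v ⇔ Star n v
mainTheorem2 (suc zero)    _ (x ∷ []) = ⇔-trans (vertex₁ x) (⇔-sym (star₁ x))
mainTheorem2 (suc (suc n)) _ v =
  let w , c , v≡w∷ʳc = initLast v in
  subst (λ u → IsVertex _ u ⇔ Star _ u) (sym v≡w∷ʳc)
        (vertex⇔star-∷ʳ w c (mainTheorem2 (suc n) (s≤s z≤n) w))
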